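{- Let $n\ge k$. For every $k\times k$ permutation matrix $P$, $\mathrm{M}(n,P)\le n^2-(k-1)n$.
   Context: All matrices are $(0,1)$-matrices. An $n\times n$ matrix $A$ is strongly $P$-forcing if for every $1$-entry $o$ of $A$ there is a $k\times k$ submatrix of $A$ (any $k$ rows and any $k$ columns, order kept) exactly equal to $P$ that contains $o$. $\mathrm{M}(n,P)$ is the maximum number of $1$-entries of an $n\times n$ strongly $P$-forcing matrix. -}

module Defs where

open import Data.Bool using (Bool; true; false; if_then_else_)
open import Data.Nat using (ℕ; _+_)
open import Data.Fin using (Fin; _<_)
open import Data.Fin.Permutation using (Permutation′; _⟨$⟩ʳ_)
open import Data.List using (List; map; allFin)
open import Data.Nat.ListAction using (sum)
open import Data.Product using (Σ; _×_; ∃; ∃-syntax)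
open import Function.Bundles using (_⇔_)
open import Relation.Binary.PropositionalEquality using (_≡_)

-- A (0,1)-matrix with m rows and n columns; true = 1-entry.
Matrix : ℕ → ℕ → Set
Matrix m n = Fin m → Fin n → Bool

IsPermutationMatrix : ∀ {k} → Matrix k k → Set
IsPermutationMatrix {k} P =
  Σ (Permutation′ k) λ σ → ∀ i j → (P i j ≡ true) ⇔ (σ ⟨$⟩ʳ i ≡ j)

StrictlyIncreasing : ∀ {k n} → (Fin k → Fin n) → Set
StrictlyIncreasing f = ∀ i j → i < j → f i < f j

OccurrenceContaining : ∀ {k n} → Matrix k k → Matrix n n → Fin n → Fin n → Set
OccurrenceContaining {k} {n} P A x y =
  Σ (Fin k → Fin n) λ r → Σ (Fin k → Fin n) λ c →
    StrictlyIncreasing r × StrictlyIncreasing c ×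
    (∀ i j → A (r i) (c j) ≡ P i j) ×
    (∃[ i ] ∃[ j ] (r i ≡ x × c j ≡ y))

StronglyForcing : ∀ {k n} → Matrix k k → Matrix n n → Set
StronglyForcing P A = ∀ x y → A x y ≡ true → OccurrenceContaining P A x y

ones : ∀ {m n} → Matrix m n → ℕ
ones {m} {n} A = sum (map (λ i → sum (map (λ j → if A i j then 1 else 0) (allFin n))) (allFin m))

-- If a 1-entry (x, y) lies in an occurrence of the permutation matrix P, then in row x
-- the occurrence has exactly one 1-entry, so the other k − 1 columns of the occurrence are
-- 0-entries of A in that row.  Hence every row of a strongly P-forcing matrix has at most
-- n − (k − 1) ones, and summing over the n rows gives the bound.
module Submission where

open import Defs
import Data.Nat.Properties as NP
open import Algebra.Properties.CommutativeSemigroup NP.+-commutativeSemigroup using (x∙yz≈y∙xz)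
open import Data.Bool using (Bool; true; false; if_then_else_)
open import Data.Bool.Properties using (¬-not) renaming (_≟_ to _≟ᵇ_)
open import Data.Fin using (Fin; zero; suc; punchIn; punchOut)
open import Data.Fin.Properties
  using ( any?; suc-injective; <-cmp; <⇒≢
        ; punchIn-injective; punchOut-injective; punchIn-punchOut; punchInᵢ≢i)
open import Data.Fin.Permutation using (_⟨$⟩ʳ_)
open import Data.List using (map; allFin)
open import Data.List.Properties using (map-tabulate)
open import Data.Nat using (ℕ; _≤_; _*_; _∸_; _+_; z≤n; s≤s)
open import Data.Nat.ListAction using (sum)
open import Data.Product using (Σ; _×_; _,_)
open import Function.Base using (_∘_)
open import Function.Bundles using (Equivalence)
open import Function.Definitions using (Injective)
open import Relation.Binary.Definitions using (tri<; tri≈; tri>)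
open import Relation.Binary.PropositionalEquality
open import Relation.Nullary using (yes; no; contradiction)

sumFin : ∀ {n} → (Fin n → ℕ) → ℕ
sumFin {n} h = sum (map h (allFin n))

indicator : Bool → ℕ
indicator b = if b then 1 else 0

rowOnes : ∀ {n} → (Fin n → Bool) → ℕ
rowOnes f = sumFin (indicator ∘ f)

sumFin-suc : ∀ {n} (h : Fin (ℕ.suc n) → ℕ) → sumFin h ≡ h zero + sumFin (h ∘ suc)
sumFin-suc h = cong (λ hs → h zero + sum hs)
  (trans (map-tabulate suc h) (sym (map-tabulate (λ i → i) (h ∘ suc))))

sumFin-punchIn : ∀ {n} (p : Fin (ℕ.suc n)) (h : Fin (ℕ.suc n) → ℕ) →
                 sumFin h ≡ h p + sumFin (h ∘ punchIn p)
sumFin-punchIn zero h = sumFin-suc h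
sumFin-punchIn {ℕ.suc n} (suc p) h = begin
  sumFin h
    ≡⟨ sumFin-suc h ⟩
  h zero + sumFin (h ∘ suc)
    ≡⟨ cong (h zero +_) (sumFin-punchIn p (h ∘ suc)) ⟩
  h zero + (h (suc p) + sumFin (h ∘ suc ∘ punchIn p))
    ≡⟨ x∙yz≈y∙xz (h zero) (h (suc p)) _ ⟩
  h (suc p) + (h zero + sumFin (h ∘ suc ∘ punchIn p))
    ≡⟨ cong (h (suc p) +_) (sym (sumFin-suc (h ∘ punchIn (suc p)))) ⟩
  h (suc p) + sumFin (h ∘ punchIn (suc p))
    ∎
  where open ≡-Reasoning

sumFin-≤ : ∀ {n} (h : Fin n → ℕ) {b} → (∀ i → h i ≤ b) → sumFin h ≤ n * b
sumFin-≤ {ℕ.zero} h h≤b = z≤n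
sumFin-≤ {ℕ.suc n} h h≤b rewrite sumFin-suc h =
  NP.+-mono-≤ (h≤b zero) (sumFin-≤ (h ∘ suc) (h≤b ∘ suc))

indicator≤1 : ∀ b → indicator b ≤ 1
indicator≤1 true = s≤s z≤n
indicator≤1 false = z≤n

rowOnes≤length : ∀ {n} (f : Fin n → Bool) → rowOnes f ≤ n
rowOnes≤length {n} f =
  subst (rowOnes f ≤_) (NP.*-identityʳ n) (sumFin-≤ _ (indicator≤1 ∘ f))

rowOnes-allFalse : ∀ {n} (f : Fin n → Bool) → (∀ j → f j ≡ false) → rowOnes f ≡ 0
rowOnes-allFalse {n} f f≡false = NP.n≤0⇒n≡0
  (subst (rowOnes f ≤_) (NP.*-zeroʳ n)
    (sumFin-≤ (indicator ∘ f) (λ j → NP.≤-reflexive (cong indicator (f≡false j)))))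

rowOnes+zeros≤length : ∀ {m n} (f : Fin n → Bool) (g : Fin m → Fin n) →
                       Injective _≡_ _≡_ g → (∀ t → f (g t) ≡ false) → rowOnes f + m ≤ n
rowOnes+zeros≤length {ℕ.zero} {n} f g _ _ =
  subst (_≤ n) (sym (NP.+-identityʳ (rowOnes f))) (rowOnes≤length f)
rowOnes+zeros≤length {ℕ.suc m} {ℕ.zero} f g _ _ with g zero
... | ()
rowOnes+zeros≤length {ℕ.suc m} {ℕ.suc n} f g g-inj fg≡false = begin
  rowOnes f + ℕ.suc m
    ≡⟨ cong (_+ ℕ.suc m) (sumFin-punchIn p (indicator ∘ f)) ⟩
  indicator (f p) + rowOnes (f ∘ punchIn p) + ℕ.suc m
    ≡⟨ cong (λ b → indicator b + rowOnes (f ∘ punchIn p) + ℕ.suc m) (fg≡false zero) ⟩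
  rowOnes (f ∘ punchIn p) + ℕ.suc m
    ≡⟨ NP.+-suc _ m ⟩
  ℕ.suc (rowOnes (f ∘ punchIn p) + m)
    ≤⟨ s≤s (rowOnes+zeros≤length (f ∘ punchIn p) g′ g′-inj f∘g′≡false) ⟩
  ℕ.suc n
    ∎
  where
  open NP.≤-Reasoning
  p = g zero
  p≢g∘suc : ∀ t → p ≢ g (suc t)
  p≢g∘suc t eq = contradiction (g-inj eq) λ ()
  g′ : Fin m → Fin n
  g′ t = punchOut (p≢g∘suc t)
  g′-inj : Injective _≡_ _≡_ g′
  g′-inj eq = suc-injective (g-inj (punchOut-injective (p≢g∘suc _) (p≢g∘suc _) eq))
  f∘g′≡false : ∀ t → f (punchIn p (g′ t)) ≡ false
  f∘g′≡false t = trans (cong f (punchIn-punchOut (p≢g∘suc t))) (fg≡false (suc t))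

strictlyIncreasing⇒injective : ∀ {k n} (c : Fin k → Fin n) → StrictlyIncreasing c →
                               Injective _≡_ _≡_ c
strictlyIncreasing⇒injective c c↑ {a} {b} eq with <-cmp a b
... | tri< a<b _ _ = contradiction eq (<⇒≢ (c↑ a b a<b))
... | tri≈ _ a≡b _ = a≡b
... | tri> _ _ b<a = contradiction (sym eq) (<⇒≢ (c↑ b a b<a))

occurrence-rowZeros : ∀ {k n} {P : Matrix (ℕ.suc k) (ℕ.suc k)} {A : Matrix n n} {x y} →
                      IsPermutationMatrix P → OccurrenceContaining P A x y → A x y ≡ true →
                      Σ (Fin k → Fin n) λ g → Injective _≡_ _≡_ g × (∀ t → A x (g t) ≡ false)
occurrence-rowZeros {A = A} (σ , isPerm) (r , c , _ , c↑ , A≡P , i , j , refl , refl) Axy =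
  g , g-inj , A∘g≡false
  where
  A≡true⇒σ : ∀ {j′} → A (r i) (c j′) ≡ true → σ ⟨$⟩ʳ i ≡ j′
  A≡true⇒σ {j′} A≡true = Equivalence.to (isPerm i j′) (trans (sym (A≡P i j′)) A≡true)
  g : Fin _ → Fin _
  g t = c (punchIn j t)
  g-inj : Injective _≡_ _≡_ g
  g-inj eq = punchIn-injective j _ _ (strictlyIncreasing⇒injective c c↑ eq)
  A∘g≡false : ∀ t → A (r i) (g t) ≡ false
  A∘g≡false t = ¬-not λ A≡true → punchInᵢ≢i j t (trans (sym (A≡true⇒σ A≡true)) (A≡true⇒σ Axy))

rowOnes≤-forcing : ∀ {k n} {P : Matrix k k} → IsPermutationMatrix P → (A : Matrix n n) →
                   StronglyForcing P A → ∀ x → rowOnes (A x) ≤ n ∸ (k ∸ 1)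
rowOnes≤-forcing {ℕ.zero} _ A _ x = rowOnes≤length (A x)
rowOnes≤-forcing {ℕ.suc k} isPerm A forcing x with any? (λ y → A x y ≟ᵇ true)
... | no noOne =
  subst (_≤ _) (sym (rowOnes-allFalse (A x) (λ y → ¬-not λ Axy → noOne (y , Axy)))) z≤n
... | yes (y , Axy) with occurrence-rowZeros isPerm (forcing x y Axy) Axy
... | g , g-inj , A∘g≡false =
  NP.m+n≤o⇒m≤o∸n _ (rowOnes+zeros≤length (A x) g g-inj A∘g≡false)

lemma9 : (n k : ℕ) → k ≤ n → (P : Matrix k k) → IsPermutationMatrix P →
         (A : Matrix n n) → StronglyForcing P A →
         ones A ≤ n * n ∸ (k ∸ 1) * n
lemma9 n k _ P isPerm A forcing = begin
  ones A              ≤⟨ sumFin-≤ (rowOnes ∘ A) (rowOnes≤-forcing isPerm A forcing) ⟩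
  n * (n ∸ (k ∸ 1))   ≡⟨ NP.*-distribˡ-∸ n n (k ∸ 1) ⟩
  n * n ∸ n * (k ∸ 1) ≡⟨ cong (n * n ∸_) (NP.*-comm n (k ∸ 1)) ⟩
  n * n ∸ (k ∸ 1) * n ∎
  where open NP.≤-Reasoning
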